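{- Let $G$ be a finite group and $H \trianglelefteq G$ a normal subgroup. Then $\mu_n(H,G) = \mu_n(1, H\backslash G)$ for all $n\geq 1$, where $H\backslash G$ is the quotient group.
   Context: For a finite group $G$, a subgroup $H$ and $n\geq 1$, let $n(H\backslash G)$ be the disjoint union of $n$ copies of the right $G$-set $H\backslash G$ of right cosets. A $G$-partition of a $G$-set $S$ is an equivalence relation $\sim$ on $S$ with $x\sim y\iff xg\sim yg$; $\Pi^*(S)^G$ is the poset (under refinement) of $G$-partitions other than the discrete and the indiscrete partition. The higher Möbius numbers are $\mu_n(H,G) = \widetilde\chi(\Pi^*(n(H\backslash G))^G)$, with the convention $\mu_1(G,G)=1$; here $\widetilde\chi$ is the reduced Euler characteristic of the order complex ($\widetilde\chi(\emptyset)=-1$). -}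

module Defs where

open import Data.Nat using (ℕ; zero; suc; _*_)
open import Data.Bool using (Bool; true; false; _∧_; _∨_; not; if_then_else_)
open import Data.Fin using (Fin; zero; suc; combine; _≟_)
open import Data.Fin.Subset using (Subset; _∈_; _∉_)
open import Data.Fin.Subset.Properties using (_∈?_)
open import Data.Product using (_×_; _,_; Σ; ∃)
open import Data.List using (List; []; _∷_; map; concatMap; filter; length; foldr)
open import Data.Integer using (ℤ; +_; -_; _+_; _^_; -1ℤ)
open import Function using (_∘_)
open import Function.Bundles using (_⇔_)
open import Relation.Binary.PropositionalEquality using (_≡_)
open import Relation.Nullary.Decidable using (isYes)
open import Relation.Nullary using (¬_)

record FinGroup : Set where
  infixl 7 _·_
  field
    N      : ℕ
    _·_    : Fin N → Fin N → Fin N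
    e      : Fin N
    inv    : Fin N → Fin N
    assoc  : ∀ x y z → (x · y) · z ≡ x · (y · z)
    identityˡ : ∀ x → e · x ≡ x
    identityʳ : ∀ x → x · e ≡ x
    inverseˡ  : ∀ x → inv x · x ≡ e
    inverseʳ  : ∀ x → x · inv x ≡ e

open FinGroup public using (N; e; inv)

record IsSubgroup (G : FinGroup) (H : Subset (N G)) : Set where
  open FinGroup G using (_·_)
  field
    e∈   : e G ∈ H
    ·∈   : ∀ {x y} → x ∈ H → y ∈ H → x · y ∈ H
    inv∈ : ∀ {x} → x ∈ H → inv G x ∈ H

record IsNormalSubgroup (G : FinGroup) (H : Subset (N G)) : Set where
  open FinGroup G using (_·_)
  field
    isSubgroup : IsSubgroup G H
    conj∈      : ∀ g {h} → h ∈ H → (inv G g · h) · g ∈ H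

IsHom : (G Q : FinGroup) → (Fin (N G) → Fin (N Q)) → Set
IsHom G Q φ = ∀ x y → φ (FinGroup._·_ G x y) ≡ FinGroup._·_ Q (φ x) (φ y)

Surjective : ∀ {A B : Set} → (A → B) → Set
Surjective {A} f = ∀ b → ∃ λ a → f a ≡ b

-- "Q is the quotient group H\G": there is a surjective homomorphism
-- G → Q whose kernel is exactly H.
IsQuotientBy : (G : FinGroup) (H : Subset (N G)) (Q : FinGroup)
             → (Fin (N G) → Fin (N Q)) → Set
IsQuotientBy G H Q φ =
  IsHom G Q φ × Surjective φ × (∀ g → (g ∈ H) ⇔ (φ g ≡ e Q))

allᵇ : ∀ {k} → (Fin k → Bool) → Bool
allᵇ {zero}  p = true
allᵇ {suc k} p = p zero ∧ allᵇ (p ∘ suc)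

consF : ∀ {k} → Bool → (Fin k → Bool) → Fin (suc k) → Bool
consF b f zero    = b
consF b f (suc i) = f i

allFns : ∀ k → List (Fin k → Bool)
allFns zero    = (λ ()) ∷ []
allFns (suc k) = concatMap (λ f → consF false f ∷ consF true f ∷ []) (allFns k)

sublists : ∀ {A : Set} → List A → List (List A)
sublists []       = [] ∷ []
sublists (x ∷ xs) = sublists xs Data.List.++ map (x ∷_) (sublists xs)

pairwiseᵇ : ∀ {A : Set} → (A → A → Bool) → List A → Bool
pairwiseᵇ r []       = true
pairwiseᵇ r (x ∷ xs) = foldr (λ y b → r x y ∧ b) true xs ∧ pairwiseᵇ r xs

-- Reduced Euler characteristic of the order complex of a finite poset,
-- given by a duplicate-free list of its elements and its order ≤ᵇ:
-- faces of the order complex are the chains (totally ordered subsets),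
-- including the empty face, and χ̃ = Σ_{chains c} (-1)^(|c|-1).
χ̃ : ∀ {A : Set} → List A → (A → A → Bool) → ℤ
χ̃ P _≤ᵇ_ = foldr (λ c s → - (-1ℤ ^ length c) + s) (+ 0)
  (filter (λ c → pairwiseᵇ (λ x y → (x ≤ᵇ y) ∨ (y ≤ᵇ x)) c Data.Bool.≟ true)
          (sublists P))

-- Since Agda has no quotient types, the right G-set n(H\G) is encoded as the
-- set Fin n × G of pairs (i , g) (standing for the coset Hg in the i-th copy)
-- modulo the coset relation (i , g) ≈ (j , g') iff i = j and g' g⁻¹ ∈ H.  Equivalence relations on n(H\G)
-- correspond bijectively to equivalence relations on Fin n × G containing ≈;
-- a G-partition of n(H\G) is thus a G-invariant such relation.

module _ (G : FinGroup) (H : Subset (N G)) (n : ℕ) where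
  open FinGroup G using (_·_)

  Pt : Set
  Pt = Fin n × Fin (N G)

  BRel : Set
  BRel = Pt → Pt → Bool

  allPtᵇ : (Pt → Bool) → Bool
  allPtᵇ p = allᵇ λ i → allᵇ λ g → p (i , g)

  _⇒ᵇ_ : Bool → Bool → Bool
  a ⇒ᵇ b = not a ∨ b

  _≈_ : BRel
  (i , g) ≈ (j , g') = isYes (i ≟ j) ∧ isYes ((g' · inv G g) ∈? H)

  act : Pt → Fin (N G) → Pt
  act (i , g) k = (i , g · k)

  allRels : List BRel
  allRels = map (λ f x y → f (combine (enc x) (enc y))) (allFns ((n * N G) * (n * N G)))
    where
    enc : Pt → Fin (n * N G)
    enc (i , g) = combine i g

  _⊆ᵇ_ : BRel → BRel → Bool
  R ⊆ᵇ S = allPtᵇ λ x → allPtᵇ λ y → R x y ⇒ᵇ S x y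

  isEquivᵇ : BRel → Bool
  isEquivᵇ R = (allPtᵇ λ x → R x x)
             ∧ (allPtᵇ λ x → allPtᵇ λ y → R x y ⇒ᵇ R y x)
             ∧ (allPtᵇ λ x → allPtᵇ λ y → allPtᵇ λ z → (R x y ∧ R y z) ⇒ᵇ R x z)

  isInvariantᵇ : BRel → Bool
  isInvariantᵇ R = allPtᵇ λ x → allPtᵇ λ y → allᵇ λ k →
    isYes (R x y Data.Bool.≟ R (act x k) (act y k))

  isGPartitionᵇ : BRel → Bool
  isGPartitionᵇ R = isEquivᵇ R ∧ (_≈_ ⊆ᵇ R) ∧ isInvariantᵇ R

  -- discrete partition of n(H\G): R = ≈ ;  indiscrete: R everything
  isDiscreteᵇ : BRel → Bool
  isDiscreteᵇ R = R ⊆ᵇ _≈_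

  isIndiscreteᵇ : BRel → Bool
  isIndiscreteᵇ R = allPtᵇ λ x → allPtᵇ λ y → R x y

  ΠStar : List BRel
  ΠStar = filter (λ R → (isGPartitionᵇ R ∧ not (isDiscreteᵇ R)
                            ∧ not (isIndiscreteᵇ R)) Data.Bool.≟ true)
                 allRels

  isWholeᵇ : Bool
  isWholeᵇ = allᵇ λ g → isYes (g ∈? H)

  isOneᵇ : ℕ → Bool
  isOneᵇ (suc zero) = true
  isOneᵇ _          = false

  -- higher Möbius number μ_n(H,G), with the convention μ_1(G,G) = 1;
  -- refinement order: R ≤ S iff R ⊆ S.
  μ : ℤ
  μ = if isOneᵇ n ∧ isWholeᵇ then + 1 else χ̃ ΠStar _⊆ᵇ_

module Submission where

-- For H normal in G with quotient map φ : G → Q = H\G, the right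
-- G-set n(H\G) is the inflation along φ of the Q-set n(1\Q): the points are the same and G
-- acts through φ.  Hence pulling back along φ is an order isomorphism between the
-- G-partitions of n(H\G) and the Q-partitions of n(1\Q), and the two posets Π* have the
-- same order complex, so the same reduced Euler characteristic.

open import Defs
open import Algebra.Bundles using (Group)
import Algebra.Properties.Group as GroupProperties
open import Data.Bool using (Bool; true; false; _∧_; _∨_; not; if_then_else_)
import Data.Bool as Bool
open import Data.Bool.Properties using (∧-comm; ∨-comm; ∧-conicalˡ; ∧-conicalʳ)
open import Data.Empty using (⊥-elim)
open import Data.Fin using (Fin; zero; suc; _≟_; combine; remQuot)
open import Data.Fin.Properties using (remQuot-combine; combine-remQuot)
open import Data.Fin.Subset using (Subset; _∈_; ⁅_⁆)
open import Data.Fin.Subset.Properties using (_∈?_; x∈⁅y⁆⇔x≡y)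
open import Data.Integer using (ℤ; +_; -_; _+_; _-_; _^_; -1ℤ)
import Data.Integer.Properties as ℤ
open import Data.Integer.Solver using (module +-*-Solver)
open import Data.List using (List; []; _∷_; _++_; map; filter; foldr; length)
open import Data.List.Properties
  using (filter-++; filter-≐; filter-accept; filter-reject; length-filter; length-map; map-++; map-∘; ++-identityʳ)
open import Data.List.Relation.Unary.Any as Any using (here; there)
import Data.List.Relation.Unary.All as All
import Data.List.Relation.Unary.All.Properties as All
import Data.List.Relation.Unary.AllPairs as AllPairs
import Data.List.Relation.Unary.AllPairs.Properties as AllPairs
open import Data.List.Relation.Unary.AllPairs using ([]; _∷_; head; tail)
import Data.List.Membership.Setoid as Membership
open import Data.List.Membership.Setoid.Properties
  using (∈-∃++; ∈-resp-≈; All[≉]⇒∉; ∈-concatMap⁺; ∈-map⁺; ∈-map⁻; ∈-filter⁺; ∈-filter⁻)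
open import Data.List.Relation.Unary.Unique.Setoid using (Unique)
import Data.List.Relation.Unary.Unique.Setoid.Properties as Unique
open import Data.List.Relation.Binary.Disjoint.Setoid using (Disjoint)
open import Data.Nat using (ℕ; zero; suc; _≤_; s≤s; _*_)
open import Data.Nat.Properties using (≤-refl; ≤-trans)
open import Data.Product using (_,_; _×_; proj₁; proj₂)
open import Function.Bundles using (_⇔_; Equivalence; mk⇔)
open import Level using (0ℓ)
open import Relation.Binary.Bundles using (Setoid)
open import Relation.Binary.PropositionalEquality
open import Relation.Nullary using (¬_; contradiction)
open import Relation.Nullary.Decidable using (isYes; Dec; yes; no)

keep : {A : Set} → (A → Bool) → List A → List A
keep p = filter (λ x → p x Bool.≟ true)

keep-map : {A B : Set} (p : B → Bool) (f : A → B) (xs : List A) →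
           keep p (map f xs) ≡ map f (keep (λ x → p (f x)) xs)
keep-map p f [] = refl
keep-map p f (x ∷ xs) with p (f x)
... | true  = cong (f x ∷_) (keep-map p f xs)
... | false = keep-map p f xs

keep-∧ : {A : Set} (p q : A → Bool) (xs : List A) →
         keep (λ x → p x ∧ q x) xs ≡ keep q (keep p xs)
keep-∧ p q [] = refl
keep-∧ p q (x ∷ xs) with p x
... | false = keep-∧ p q xs
... | true with q x
...   | true  = cong (x ∷_) (keep-∧ p q xs)
...   | false = keep-∧ p q xs

keep-cong : {A : Set} {p q : A → Bool} → (∀ x → p x ≡ q x) → (xs : List A) → keep p xs ≡ keep q xs
keep-cong p≡q = filter-≐ _ _ ((λ {x} e → trans (sym (p≡q x)) e) , (λ {x} e → trans (p≡q x) e))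

keep-comm : {A : Set} (p q : A → Bool) (xs : List A) →
            keep q (keep p xs) ≡ keep p (keep q xs)
keep-comm p q xs = begin
  keep q (keep p xs)            ≡⟨ keep-∧ p q xs ⟨
  keep (λ x → p x ∧ q x) xs     ≡⟨ keep-cong (λ x → ∧-comm (p x) (q x)) xs ⟩
  keep (λ x → q x ∧ p x) xs     ≡⟨ keep-∧ q p xs ⟩
  keep p (keep q xs)            ∎
  where open ≡-Reasoning

every : {A : Set} → (A → Bool) → List A → Bool
every q = foldr (λ y b → q y ∧ b) true

keep-every-sublists : {A : Set} (q : A → Bool) (xs : List A) →
                      keep (every q) (sublists xs) ≡ sublists (keep q xs)
keep-every-sublists q [] = refl
keep-every-sublists q (x ∷ xs) = begin
  keep (every q) (sublists xs ++ map (x ∷_) (sublists xs))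
    ≡⟨ filter-++ _ (sublists xs) _ ⟩
  keep (every q) (sublists xs) ++ keep (every q) (map (x ∷_) (sublists xs))
    ≡⟨ cong₂ _++_ (keep-every-sublists q xs) (keep-map (every q) (x ∷_) (sublists xs)) ⟩
  sublists (keep q xs) ++ map (x ∷_) (keep (λ s → q x ∧ every q s) (sublists xs))
    ≡⟨ extend (q x) refl ⟩
  sublists (keep q (x ∷ xs)) ∎
  where
  open ≡-Reasoning
  extend : ∀ b → q x ≡ b →
           sublists (keep q xs) ++ map (x ∷_) (keep (λ s → b ∧ every q s) (sublists xs))
           ≡ sublists (keep q (x ∷ xs))
  extend true  qx rewrite qx = cong (λ S → sublists (keep q xs) ++ map (x ∷_) S) (keep-every-sublists q xs)
  extend false qx rewrite qx = trans (cong (λ S → sublists (keep q xs) ++ map (x ∷_) S) (rejectAll (sublists xs)))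
                                     (++-identityʳ _)
    where
    rejectAll : (S : List (List _)) → keep (λ _ → false) S ≡ []
    rejectAll [] = refl
    rejectAll (_ ∷ S) = rejectAll S

chains : {A : Set} → (A → A → Bool) → List A → List (List A)
chains c xs = keep (pairwiseᵇ c) (sublists xs)

-- A chain with k elements is a (k-1)-face and contributes (-1)^(k-1).
faceSign : {A : Set} → List A → ℤ
faceSign s = - (-1ℤ ^ length s)

signSum : {A : Set} → List (List A) → ℤ
signSum = foldr (λ s t → faceSign s + t) (+ 0)

chainSum : {A : Set} → (A → A → Bool) → List A → ℤ
chainSum c xs = signSum (chains c xs)

-- The comparability relation of an order; χ̃ P r unfolds to chainSum (comparable r) P.
comparable : {A : Set} → (A → A → Bool) → A → A → Bool
comparable r x y = r x y ∨ r y x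

signSum-++ : {A : Set} (S T : List (List A)) → signSum (S ++ T) ≡ signSum S + signSum T
signSum-++ [] T = sym (ℤ.+-identityˡ _)
signSum-++ (s ∷ S) T = trans (cong (λ t → faceSign s + t) (signSum-++ S T)) (sym (ℤ.+-assoc (faceSign s) _ _))

signSum-cons : {A : Set} (x : A) (S : List (List A)) → signSum (map (x ∷_) S) ≡ - signSum S
signSum-cons x [] = refl
signSum-cons x (s ∷ S) = begin
  faceSign (x ∷ s) + signSum (map (x ∷_) S) ≡⟨ cong₂ _+_ (cong -_ (ℤ.-1*i≡-i (-1ℤ ^ length s))) (signSum-cons x S) ⟩
  - faceSign s + - signSum S                ≡⟨ ℤ.neg-distrib-+ (faceSign s) (signSum S) ⟨
  - (faceSign s + signSum S)                ∎
  where open ≡-Reasoning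

chains-cons : {A : Set} (c : A → A → Bool) (x : A) (xs : List A) →
              chains c (x ∷ xs) ≡ chains c xs ++ map (x ∷_) (chains c (keep (c x) xs))
chains-cons c x xs = begin
  keep (pairwiseᵇ c) (sublists xs ++ map (x ∷_) (sublists xs))
    ≡⟨ filter-++ _ (sublists xs) _ ⟩
  chains c xs ++ keep (pairwiseᵇ c) (map (x ∷_) (sublists xs))
    ≡⟨ cong (chains c xs ++_) (keep-map (pairwiseᵇ c) (x ∷_) (sublists xs)) ⟩
  chains c xs ++ map (x ∷_) (keep (λ s → every (c x) s ∧ pairwiseᵇ c s) (sublists xs))
    ≡⟨ cong (λ S → chains c xs ++ map (x ∷_) S) (keep-∧ (every (c x)) (pairwiseᵇ c) (sublists xs)) ⟩
  chains c xs ++ map (x ∷_) (keep (pairwiseᵇ c) (keep (every (c x)) (sublists xs)))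
    ≡⟨ cong (λ S → chains c xs ++ map (x ∷_) (keep (pairwiseᵇ c) S)) (keep-every-sublists (c x) xs) ⟩
  chains c xs ++ map (x ∷_) (chains c (keep (c x) xs)) ∎
  where open ≡-Reasoning

chainSum-cons : {A : Set} (c : A → A → Bool) (x : A) (xs : List A) →
                chainSum c (x ∷ xs) ≡ chainSum c xs - chainSum c (keep (c x) xs)
chainSum-cons c x xs = begin
  signSum (chains c (x ∷ xs))
    ≡⟨ cong signSum (chains-cons c x xs) ⟩
  signSum (chains c xs ++ map (x ∷_) (chains c (keep (c x) xs)))
    ≡⟨ signSum-++ (chains c xs) _ ⟩
  chainSum c xs + signSum (map (x ∷_) (chains c (keep (c x) xs)))
    ≡⟨ cong (λ t → chainSum c xs + t) (signSum-cons x (chains c (keep (c x) xs))) ⟩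
  chainSum c xs - chainSum c (keep (c x) xs) ∎
  where open ≡-Reasoning

module _ {A B : Set} (g : A → B) where

  sublists-map : (xs : List A) → sublists (map g xs) ≡ map (map g) (sublists xs)
  sublists-map [] = refl
  sublists-map (x ∷ xs) = begin
    sublists (map g xs) ++ map (g x ∷_) (sublists (map g xs))
      ≡⟨ cong (λ S → S ++ map (g x ∷_) S) (sublists-map xs) ⟩
    map (map g) (sublists xs) ++ map (g x ∷_) (map (map g) (sublists xs))
      ≡⟨ cong (map (map g) (sublists xs) ++_) (trans (sym (map-∘ (sublists xs))) (map-∘ (sublists xs))) ⟩
    map (map g) (sublists xs) ++ map (map g) (map (x ∷_) (sublists xs))
      ≡⟨ map-++ (map g) (sublists xs) _ ⟨
    map (map g) (sublists xs ++ map (x ∷_) (sublists xs)) ∎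
    where open ≡-Reasoning

  pairwise-map : (c : B → B → Bool) (d : A → A → Bool) → (∀ a b → c (g a) (g b) ≡ d a b) →
                 ∀ s → pairwiseᵇ c (map g s) ≡ pairwiseᵇ d s
  pairwise-map c d c≡d [] = refl
  pairwise-map c d c≡d (x ∷ s) = cong₂ _∧_ (every-map s) (pairwise-map c d c≡d s)
    where
    every-map : ∀ s → every (c (g x)) (map g s) ≡ every (d x) s
    every-map [] = refl
    every-map (y ∷ s) = cong₂ _∧_ (c≡d x y) (every-map s)

  signSum-map : (S : List (List A)) → signSum (map (map g) S) ≡ signSum S
  signSum-map [] = refl
  signSum-map (s ∷ S) = cong₂ (λ n t → - (-1ℤ ^ n) + t) (length-map g s) (signSum-map S)

  chainSum-map : (c : B → B → Bool) (d : A → A → Bool) → (∀ a b → c (g a) (g b) ≡ d a b) →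
                 ∀ xs → chainSum c (map g xs) ≡ chainSum d xs
  chainSum-map c d c≡d xs = begin
    signSum (keep (pairwiseᵇ c) (sublists (map g xs)))
      ≡⟨ cong (λ S → signSum (keep (pairwiseᵇ c) S)) (sublists-map xs) ⟩
    signSum (keep (pairwiseᵇ c) (map (map g) (sublists xs)))
      ≡⟨ cong signSum (keep-map (pairwiseᵇ c) (map g) (sublists xs)) ⟩
    signSum (map (map g) (keep (λ s → pairwiseᵇ c (map g s)) (sublists xs)))
      ≡⟨ signSum-map (keep (λ s → pairwiseᵇ c (map g s)) (sublists xs)) ⟩
    signSum (keep (λ s → pairwiseᵇ c (map g s)) (sublists xs))
      ≡⟨ cong signSum (keep-cong (pairwise-map c d c≡d) (sublists xs)) ⟩
    chainSum d xs ∎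
    where open ≡-Reasoning

-- Contribution of the chains through both of the first two elements.
pairTerm : {A : Set} (c : A → A → Bool) (x y : A) (xs : List A) → ℤ
pairTerm c x y xs = if c x y then chainSum c (keep (c y) (keep (c x) xs)) else + 0

-- Two steps of the recursion; the right-hand side is visibly symmetric in x and y
-- (up to the order of the two filters in pairTerm).
chainSum-pair : {A : Set} (c : A → A → Bool) (x y : A) (xs : List A) →
                chainSum c (x ∷ y ∷ xs)
                ≡ chainSum c xs - (chainSum c (keep (c x) xs) + chainSum c (keep (c y) xs))
                  + pairTerm c x y xs
chainSum-pair c x y xs with c x y in cxy
... | true = begin
  chainSum c (x ∷ y ∷ xs)
    ≡⟨ chainSum-cons c x (y ∷ xs) ⟩
  chainSum c (y ∷ xs) - chainSum c (keep (c x) (y ∷ xs))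
    ≡⟨ cong₂ _-_ (chainSum-cons c y xs)
                 (cong (chainSum c) (filter-accept (λ z → c x z Bool.≟ true) cxy)) ⟩
  (A - Cy) - chainSum c (y ∷ keep (c x) xs)
    ≡⟨ cong (λ t → (A - Cy) - t) (chainSum-cons c y (keep (c x) xs)) ⟩
  (A - Cy) - (Cx - D)
    ≡⟨ solve 4 (λ a cx cy d → (a :- cy) :- (cx :- d) := (a :- (cx :+ cy)) :+ d) refl A Cx Cy D ⟩
  A - (Cx + Cy) + D ∎
  where
  open ≡-Reasoning
  open +-*-Solver
  A  = chainSum c xs
  Cx = chainSum c (keep (c x) xs)
  Cy = chainSum c (keep (c y) xs)
  D  = chainSum c (keep (c y) (keep (c x) xs))
... | false = begin
  chainSum c (x ∷ y ∷ xs)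
    ≡⟨ chainSum-cons c x (y ∷ xs) ⟩
  chainSum c (y ∷ xs) - chainSum c (keep (c x) (y ∷ xs))
    ≡⟨ cong₂ _-_ (chainSum-cons c y xs)
                 (cong (chainSum c) (filter-reject (λ z → c x z Bool.≟ true)
                                                   λ e → contradiction (trans (sym cxy) e) λ ())) ⟩
  (A - Cy) - Cx
    ≡⟨ solve 3 (λ a cx cy → (a :- cy) :- cx := (a :- (cx :+ cy)) :+ con (+ 0)) refl A Cx Cy ⟩
  A - (Cx + Cy) + + 0 ∎
  where
  open ≡-Reasoning
  open +-*-Solver
  A  = chainSum c xs
  Cx = chainSum c (keep (c x) xs)
  Cy = chainSum c (keep (c y) xs)

-- Chain sums are invariant under permutations up to a setoid equality that the
-- comparability test respects; c must be symmetric so that swapping two elements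
-- does not change the pair term.
module PermutationInvariance {ℓ} (S : Setoid 0ℓ ℓ) (c : Setoid.Carrier S → Setoid.Carrier S → Bool)
  (c-sym : ∀ x y → c x y ≡ c y x)
  (c-resp : ∀ {x x′ y y′} → Setoid._≈_ S x x′ → Setoid._≈_ S y y′ → c x y ≡ c x′ y′) where

  open Setoid S using () renaming (_≈_ to _≃_; refl to ≃-refl)
  open import Data.List.Relation.Binary.Permutation.Setoid S using (_↭_)
  import Data.List.Relation.Binary.Permutation.Setoid S as Perm
  open import Data.List.Relation.Binary.Permutation.Setoid.Properties S using (xs↭ys⇒|xs|≡|ys|)
  import Data.List.Relation.Binary.Permutation.Setoid.Properties S as ↭
  open import Data.List.Relation.Binary.Equality.Setoid S using (_≋_; []; _∷_)
  import Data.List.Relation.Binary.Equality.Setoid S as ≋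

  private
    passes : ∀ z {u v} → u ≃ v → c z u ≡ true → c z v ≡ true
    passes z u≃v e = trans (sym (c-resp ≃-refl u≃v)) e

    filterLength : ∀ z {k} xs → length xs ≤ k → length (keep (c z) xs) ≤ k
    filterLength z xs l = ≤-trans (length-filter _ xs) l

  cons-step : ∀ {x y} xs ys → x ≃ y → chainSum c xs ≡ chainSum c ys →
              chainSum c (keep (c x) xs) ≡ chainSum c (keep (c x) ys) →
              chainSum c (x ∷ xs) ≡ chainSum c (y ∷ ys)
  cons-step {x} {y} xs ys x≃y same sameFiltered = begin
    chainSum c (x ∷ xs)                         ≡⟨ chainSum-cons c x xs ⟩
    chainSum c xs - chainSum c (keep (c x) xs)   ≡⟨ cong₂ _-_ same sameFiltered ⟩
    chainSum c ys - chainSum c (keep (c x) ys)   ≡⟨ cong (λ t → chainSum c ys - chainSum c t)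
                                                         (keep-cong (λ z → c-resp x≃y ≃-refl) ys) ⟩
    chainSum c ys - chainSum c (keep (c y) ys)   ≡⟨ chainSum-cons c y ys ⟨
    chainSum c (y ∷ ys) ∎
    where open ≡-Reasoning

  -- The recursion descends into filtered lists, so the induction is on a length bound k:
  -- first for pointwise equal lists, then for permutations.
  bounded-≋ : ∀ k {xs ys} → length xs ≤ k → xs ≋ ys → chainSum c xs ≡ chainSum c ys
  bounded-≋ k l [] = refl
  bounded-≋ (suc k) {x ∷ xs} {y ∷ ys} (s≤s l) (x≃y ∷ xs≋ys) =
    cons-step xs ys x≃y (bounded-≋ k l xs≋ys)
      (bounded-≋ k (filterLength x xs l) (≋.filter⁺ _ (passes x) xs≋ys))

  bounded-↭ : ∀ k {xs ys} → length xs ≤ k → xs ↭ ys → chainSum c xs ≡ chainSum c ys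
  bounded-↭ k l (Perm.refl xs≋ys) = bounded-≋ k l xs≋ys
  bounded-↭ k l (Perm.trans p q) =
    trans (bounded-↭ k l p) (bounded-↭ k (subst (_≤ k) (xs↭ys⇒|xs|≡|ys| p) l) q)
  bounded-↭ (suc k) {x ∷ xs} {y ∷ ys} (s≤s l) (Perm.prep x≃y p) =
    cons-step xs ys x≃y (bounded-↭ k l p) (bounded-↭ k (filterLength x xs l) (↭.filter⁺ _ (passes x) p))
  bounded-↭ (suc (suc k)) (s≤s (s≤s l)) (Perm.swap {xs} {ys} {x} {y} {x′} {y′} x≃x′ y≃y′ p) = begin
    chainSum c (x ∷ y ∷ xs)
      ≡⟨ chainSum-pair c x y xs ⟩
    chainSum c xs - (chainSum c (keep (c x) xs) + chainSum c (keep (c y) xs)) + pairTerm c x y xs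
      ≡⟨ cong₂ _+_ (cong₂ _-_ (bounded-↭ k l p) sameSingles) samePair ⟩
    chainSum c ys - (chainSum c (keep (c y′) ys) + chainSum c (keep (c x′) ys)) + pairTerm c y′ x′ ys
      ≡⟨ chainSum-pair c y′ x′ ys ⟨
    chainSum c (y′ ∷ x′ ∷ ys) ∎
    where
    open ≡-Reasoning
    filtered : ∀ {z z′} → z ≃ z′ → ∀ {us vs} → length us ≤ k → us ↭ vs →
               chainSum c (keep (c z) us) ≡ chainSum c (keep (c z′) vs)
    filtered {z} z≃z′ {us} {vs} l′ q =
      trans (bounded-↭ k (filterLength z us l′) (↭.filter⁺ _ (passes z) q))
            (cong (chainSum c) (keep-cong (λ u → c-resp z≃z′ ≃-refl) vs))
    sameX : chainSum c (keep (c x) xs) ≡ chainSum c (keep (c x′) ys)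
    sameX = filtered x≃x′ l p
    sameY : chainSum c (keep (c y) xs) ≡ chainSum c (keep (c y′) ys)
    sameY = filtered y≃y′ l p
    sameBoth : chainSum c (keep (c y) (keep (c x) xs)) ≡ chainSum c (keep (c x′) (keep (c y′) ys))
    sameBoth = trans (filtered y≃y′ (filterLength x xs l) (↭.filter⁺ _ (passes x) p))
                     (cong (chainSum c) (trans (cong (keep (c y′)) (keep-cong (λ u → c-resp x≃x′ ≃-refl) ys))
                                               (keep-comm (c x′) (c y′) ys)))
    sameSingles : chainSum c (keep (c x) xs) + chainSum c (keep (c y) xs)
                  ≡ chainSum c (keep (c y′) ys) + chainSum c (keep (c x′) ys)
    sameSingles = trans (cong₂ _+_ sameX sameY) (ℤ.+-comm (chainSum c (keep (c x′) ys)) _)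
    samePair : pairTerm c x y xs ≡ pairTerm c y′ x′ ys
    samePair = cong₂ (λ b t → if b then t else + 0) (trans (c-resp x≃x′ y≃y′) (c-sym x′ y′)) sameBoth

  chainSum-↭ : ∀ {xs ys} → xs ↭ ys → chainSum c xs ≡ chainSum c ys
  chainSum-↭ {xs} = bounded-↭ (length xs) ≤-refl

module _ {a ℓ} (S : Setoid a ℓ) where

  open Setoid S using () renaming (refl to ≈-refl; sym to ≈-sym; trans to ≈-trans)
  open Membership S using () renaming (_∈_ to _∈ₗ_)
  open import Data.List.Relation.Binary.Permutation.Setoid S using (_↭_; ↭-refl; ↭-sym; ↭-trans; ↭-reflexive-≋; prep)
  open import Data.List.Relation.Binary.Permutation.Setoid.Properties S using (shift; ∈-resp-↭; Unique-resp-↭)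

  unique-↭ : ∀ {xs ys} → Unique S xs → Unique S ys →
             (∀ {z} → z ∈ₗ xs → z ∈ₗ ys) → (∀ {z} → z ∈ₗ ys → z ∈ₗ xs) → xs ↭ ys
  unique-↭ {[]} {[]} _ _ _ _ = ↭-refl
  unique-↭ {[]} {y ∷ ys} _ _ _ ys⊆xs with ys⊆xs (here ≈-refl)
  ... | ()
  unique-↭ {x ∷ xs} {ys} (x∉xs ∷ xs!) ys! xs⊆ys ys⊆xs
    with us , vs , w , x≈w , ys≋ ← ∈-∃++ S (xs⊆ys (here ≈-refl)) =
    ↭-trans (prep x≈w (unique-↭ xs! rest! xs⊆rest rest⊆xs)) (↭-sym ys↭)
    where
    ys↭ : ys ↭ w ∷ us ++ vs
    ys↭ = ↭-trans (↭-reflexive-≋ ys≋) (shift ≈-refl us vs)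
    w∷rest! : Unique S (w ∷ us ++ vs)
    w∷rest! = Unique-resp-↭ ys↭ ys!
    rest! : Unique S (us ++ vs)
    rest! = tail w∷rest!
    xs⊆rest : ∀ {z} → z ∈ₗ xs → z ∈ₗ us ++ vs
    xs⊆rest {z} z∈xs with ∈-resp-↭ ys↭ (xs⊆ys (there z∈xs))
    ... | here z≈w = ⊥-elim (All[≉]⇒∉ S x∉xs (∈-resp-≈ S (≈-trans z≈w (≈-sym x≈w)) z∈xs))
    ... | there z∈rest = z∈rest
    rest⊆xs : ∀ {z} → z ∈ₗ us ++ vs → z ∈ₗ xs
    rest⊆xs {z} z∈rest with ys⊆xs (∈-resp-↭ (↭-sym ys↭) (there z∈rest))
    ... | here z≈x = ⊥-elim (All[≉]⇒∉ S (head w∷rest!) (∈-resp-≈ S (≈-trans z≈x x≈w) z∈rest))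
    ... | there z∈xs = z∈xs

bool-ext : ∀ {a b : Bool} → (a ≡ true → b ≡ true) → (b ≡ true → a ≡ true) → a ≡ b
bool-ext {false} {false} _ _ = refl
bool-ext {false} {true}  _ b⇒a = b⇒a refl
bool-ext {true}  {b}     a⇒b _ = sym (a⇒b refl)

allᵇ-sound : ∀ {k} (p : Fin k → Bool) → allᵇ p ≡ true → ∀ i → p i ≡ true
allᵇ-sound p all zero    = ∧-conicalˡ (p zero) _ all
allᵇ-sound p all (suc i) = allᵇ-sound (λ j → p (suc j)) (∧-conicalʳ (p zero) _ all) i

allᵇ-complete : ∀ {k} (p : Fin k → Bool) → (∀ i → p i ≡ true) → allᵇ p ≡ true
allᵇ-complete {zero}  p _ = refl
allᵇ-complete {suc k} p h rewrite h zero = allᵇ-complete (λ j → p (suc j)) (λ j → h (suc j))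

allᵇ-transport : ∀ {a b} (f : Fin a → Fin b) → Surjective f → (p : Fin a → Bool) (q : Fin b → Bool) →
                 (∀ i → p i ≡ q (f i)) → allᵇ p ≡ allᵇ q
allᵇ-transport f f-onto p q p≡qf = bool-ext
  (λ all-p → allᵇ-complete q λ j → let (i , fi≡j) = f-onto j in
     subst (λ j → q j ≡ true) fi≡j (trans (sym (p≡qf i)) (allᵇ-sound p all-p i)))
  (λ all-q → allᵇ-complete p λ i → trans (p≡qf i) (allᵇ-sound q all-q (f i)))

allPt-sound : ∀ K L n (p : Pt K L n → Bool) → allPtᵇ K L n p ≡ true → ∀ x → p x ≡ true
allPt-sound K L n p all (i , g) = allᵇ-sound _ (allᵇ-sound _ all i) g

isYes-⇔ : ∀ {P P' : Set} (p : Dec P) (p' : Dec P') → P ⇔ P' → isYes p ≡ isYes p'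
isYes-⇔ (yes _) (yes _)  _      = refl
isYes-⇔ (yes a) (no ¬a') a⇔a'   = ⊥-elim (¬a' (Equivalence.to a⇔a' a))
isYes-⇔ (no ¬a) (yes a') a⇔a'   = ⊥-elim (¬a (Equivalence.from a⇔a' a'))
isYes-⇔ (no _)  (no _)   _      = refl

isYes-true : ∀ {P : Set} (p : Dec P) → P → isYes p ≡ true
isYes-true p a = isYes-⇔ p (yes a) (mk⇔ (λ _ → a) (λ _ → a))

≈-reflexive : ∀ K L n → e K ∈ L → ∀ x → _≈_ K L n x x ≡ true
≈-reflexive K L n e∈L (i , g) = cong₂ _∧_ (isYes-true (i ≟ i) refl)
  (isYes-true (_ ∈? L) (subst (_∈ L) (sym (FinGroup.inverseʳ K g)) e∈L))

partition-resp-≈ : ∀ K L n (R : BRel K L n) → isGPartitionᵇ K L n R ≡ true →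
                   ∀ {x x' y y'} → _≈_ K L n x x' ≡ true → _≈_ K L n y y' ≡ true → R x y ≡ R x' y'
partition-resp-≈ K L n R part {x} {x'} {y} {y'} x≈x' y≈y' = bool-ext
  (λ r → trans-R (trans-R (sym-R (≈⊆R x≈x')) r) (≈⊆R y≈y'))
  (λ r → trans-R (trans-R (≈⊆R x≈x') r) (sym-R (≈⊆R y≈y')))
  where
  holds : (p : Pt K L n → Bool) → allPtᵇ K L n p ≡ true → ∀ x → p x ≡ true
  holds = allPt-sound K L n
  ⇒-true : ∀ {a b} → (not a ∨ b) ≡ true → a ≡ true → b ≡ true
  ⇒-true e refl = e
  equivalence : isEquivᵇ K L n R ≡ true
  equivalence = ∧-conicalˡ (isEquivᵇ K L n R) _ part
  symmetric : allPtᵇ K L n (λ a → allPtᵇ K L n (λ b → not (R a b) ∨ R b a)) ≡ true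
  symmetric = ∧-conicalˡ _ _ (∧-conicalʳ (allPtᵇ K L n (λ a → R a a)) _ equivalence)
  transitive : allPtᵇ K L n (λ a → allPtᵇ K L n (λ b → allPtᵇ K L n (λ c →
                 not (R a b ∧ R b c) ∨ R a c))) ≡ true
  transitive = ∧-conicalʳ _ _ (∧-conicalʳ (allPtᵇ K L n (λ a → R a a)) _ equivalence)
  coarser : allPtᵇ K L n (λ a → allPtᵇ K L n (λ b → not (_≈_ K L n a b) ∨ R a b)) ≡ true
  coarser = ∧-conicalˡ _ _ (∧-conicalʳ (isEquivᵇ K L n R) _ part)
  sym-R : ∀ {a b} → R a b ≡ true → R b a ≡ true
  sym-R {a} {b} = ⇒-true (holds _ (holds _ symmetric a) b)
  trans-R : ∀ {a b c} → R a b ≡ true → R b c ≡ true → R a c ≡ true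
  trans-R {a} {b} {c} r s = ⇒-true (holds _ (holds _ (holds _ transitive a) b) c) (cong₂ _∧_ r s)
  ≈⊆R : ∀ {a b} → _≈_ K L n a b ≡ true → R a b ≡ true
  ≈⊆R {a} {b} = ⇒-true (holds _ (holds _ coarser a) b)

isProperᵇ : ∀ K L n → BRel K L n → Bool
isProperᵇ K L n R = isGPartitionᵇ K L n R ∧ not (isDiscreteᵇ K L n R) ∧ not (isIndiscreteᵇ K L n R)

_≐_ : {X : Set} → (X → X → Bool) → (X → X → Bool) → Set
R ≐ S = ∀ x y → R x y ≡ S x y

-- It makes the K-set n(L\K)
-- the inflation along ψ of the K'-set n(L'\K').
record Inflation (K K' : FinGroup) (L : Subset (N K)) (L' : Subset (N K')) : Set where
  field
    ψ           : Fin (N K) → Fin (N K')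
    surjective  : Surjective ψ
    homomorphic : IsHom K K' ψ
    sameCoset   : ∀ g g' → isYes (FinGroup._·_ K g' (inv K g) ∈? L)
                           ≡ isYes (FinGroup._·_ K' (ψ g') (inv K' (ψ g)) ∈? L')

-- The identity inflation; transporting along it shows that everything respects ≐.
idInflation : ∀ K L → Inflation K K L L
idInflation K L = record
  { ψ = λ g → g ; surjective = λ g → g , refl ; homomorphic = λ _ _ → refl ; sameCoset = λ _ _ → refl }

module Transport {K K' L L'} (I : Inflation K K' L L') (n : ℕ) where
  open Inflation I

  lift : Pt K L n → Pt K' L' n
  lift (i , g) = i , ψ g

  pullback : BRel K' L' n → BRel K L n
  pullback S x y = S (lift x) (lift y)

  allPt-transport : (p : Pt K L n → Bool) (q : Pt K' L' n → Bool) → (∀ x → p x ≡ q (lift x)) →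
                    allPtᵇ K L n p ≡ allPtᵇ K' L' n q
  allPt-transport p q p≡q = allᵇ-transport (λ i → i) (λ i → i , refl) _ _ λ i →
    allᵇ-transport ψ surjective _ _ λ g → p≡q (i , g)

  ≈-lift : ∀ x y → _≈_ K L n x y ≡ _≈_ K' L' n (lift x) (lift y)
  ≈-lift (i , g) (j , g') = cong (isYes (i ≟ j) ∧_) (sameCoset g g')

  act-lift : ∀ x k → lift (act K L n x k) ≡ act K' L' n (lift x) (ψ k)
  act-lift (i , g) k = cong (i ,_) (homomorphic g k)

  ⊆-transport : ∀ {R R' S S'} → R ≐ pullback S → R' ≐ pullback S' →
                _⊆ᵇ_ K L n R R' ≡ _⊆ᵇ_ K' L' n S S'
  ⊆-transport R≐ R'≐ = allPt-transport _ _ λ x → allPt-transport _ _ λ y →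
    cong₂ (λ a b → not a ∨ b) (R≐ x y) (R'≐ x y)

  proper-transport : ∀ {R S} → R ≐ pullback S → isProperᵇ K L n R ≡ isProperᵇ K' L' n S
  proper-transport {R} {S} R≐ =
    cong₂ _∧_ (cong₂ _∧_ equivalence (cong₂ _∧_ coarser invariant))
              (cong₂ _∧_ (cong not discrete) (cong not indiscrete))
    where
    ∀₁ : (p : Pt K L n → Bool) (q : Pt K' L' n → Bool) → (∀ x → p x ≡ q (lift x)) →
         allPtᵇ K L n p ≡ allPtᵇ K' L' n q
    ∀₁ = allPt-transport
    implies : ∀ {a a' b b'} → a ≡ a' → b ≡ b' → (not a ∨ b) ≡ (not a' ∨ b')
    implies = cong₂ (λ a b → not a ∨ b)
    equivalence : isEquivᵇ K L n R ≡ isEquivᵇ K' L' n S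
    equivalence = cong₂ _∧_ (∀₁ _ _ λ x → R≐ x x) (cong₂ _∧_
      (∀₁ _ _ λ x → ∀₁ _ _ λ y → implies (R≐ x y) (R≐ y x))
      (∀₁ _ _ λ x → ∀₁ _ _ λ y → ∀₁ _ _ λ z → implies (cong₂ _∧_ (R≐ x y) (R≐ y z)) (R≐ x z)))
    coarser : _⊆ᵇ_ K L n (_≈_ K L n) R ≡ _⊆ᵇ_ K' L' n (_≈_ K' L' n) S
    coarser = ⊆-transport {S = _≈_ K' L' n} {S' = S} ≈-lift R≐
    invariant : isInvariantᵇ K L n R ≡ isInvariantᵇ K' L' n S
    invariant = ∀₁ _ _ λ x → ∀₁ _ _ λ y → allᵇ-transport ψ surjective _ _ λ k →
      cong₂ (λ a b → isYes (a Bool.≟ b)) (R≐ x y)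
            (trans (R≐ (act K L n x k) (act K L n y k)) (cong₂ S (act-lift x k) (act-lift y k)))
    discrete : isDiscreteᵇ K L n R ≡ isDiscreteᵇ K' L' n S
    discrete = ⊆-transport {S = S} {S' = _≈_ K' L' n} R≐ ≈-lift
    indiscrete : isIndiscreteᵇ K L n R ≡ isIndiscreteᵇ K' L' n S
    indiscrete = ∀₁ _ _ λ x → ∀₁ _ _ λ y → R≐ x y

  lower : Pt K' L' n → Pt K L n
  lower (i , q) = i , proj₁ (surjective q)

  lift-lower : ∀ x → lift (lower x) ≡ x
  lift-lower (i , q) = cong (i ,_) (proj₂ (surjective q))

  descend : BRel K L n → BRel K' L' n
  descend R x y = R (lower x) (lower y)

  pullback-injective : ∀ {S S'} → pullback S ≐ pullback S' → S ≐ S'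
  pullback-injective {S} {S'} eq x y = begin
    S x y                           ≡⟨ cong₂ S (lift-lower x) (lift-lower y) ⟨
    pullback S (lower x) (lower y)  ≡⟨ eq (lower x) (lower y) ⟩
    pullback S' (lower x) (lower y) ≡⟨ cong₂ S' (lift-lower x) (lift-lower y) ⟩
    S' x y                          ∎
    where open ≡-Reasoning

  -- A G-partition of n(L\K) is constant on the fibres of lift, so it is pulled back
  -- from its descent.  (The fibres of lift are ≈-classes once ≈ is reflexive.)
  pullback-descend : (∀ x → _≈_ K L n x x ≡ true) →
                     ∀ R → isGPartitionᵇ K L n R ≡ true → R ≐ pullback (descend R)
  pullback-descend ≈-refl R part x y = partition-resp-≈ K L n R part (sameFibre x) (sameFibre y)
    where
    sameFibre : ∀ x → _≈_ K L n x (lower (lift x)) ≡ true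
    sameFibre x = begin
      _≈_ K L n x (lower (lift x))                 ≡⟨ ≈-lift x (lower (lift x)) ⟩
      _≈_ K' L' n (lift x) (lift (lower (lift x))) ≡⟨ cong (_≈_ K' L' n (lift x)) (lift-lower (lift x)) ⟩
      _≈_ K' L' n (lift x) (lift x)                ≡⟨ ≈-lift x x ⟨
      _≈_ K L n x x                                ≡⟨ ≈-refl x ⟩
      true                                         ∎
      where open ≡-Reasoning


toGroup : FinGroup → Group 0ℓ 0ℓ
toGroup K = record
  { Carrier = Fin (N K) ; _≈_ = _≡_ ; _∙_ = _·_ ; ε = e K ; _⁻¹ = inv K
  ; isGroup = record
    { isMonoid = record
      { isSemigroup = record
        { isMagma = record { isEquivalence = isEquivalence ; ∙-cong = cong₂ _·_ }
        ; assoc = assoc }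
      ; identity = identityˡ , identityʳ }
    ; inverse = inverseˡ , inverseʳ
    ; ⁻¹-cong = cong (inv K) } }
  where open FinGroup K

module Quotient (G : FinGroup) (H : Subset (N G)) (Q : FinGroup) (φ : Fin (N G) → Fin (N Q))
                (quotient : IsQuotientBy G H Q φ) where
  open FinGroup G using () renaming (_·_ to _·G_)
  open FinGroup Q using () renaming (_·_ to _·Q_)
  open GroupProperties (toGroup Q) using (identityˡ-unique; inverseʳ-unique)

  homomorphic : IsHom G Q φ
  homomorphic = proj₁ quotient

  kernel : ∀ g → (g ∈ H) ⇔ (φ g ≡ e Q)
  kernel = proj₂ (proj₂ quotient)

  φ-e : φ (e G) ≡ e Q
  φ-e = identityˡ-unique (φ (e G)) (φ (e G))
          (trans (sym (homomorphic (e G) (e G))) (cong φ (FinGroup.identityˡ G (e G))))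

  φ-inv : ∀ g → φ (inv G g) ≡ inv Q (φ g)
  φ-inv g = inverseʳ-unique (φ g) (φ (inv G g))
              (trans (sym (homomorphic g (inv G g))) (trans (cong φ (FinGroup.inverseʳ G g)) φ-e))

  inKernel : ∀ g → (g ∈ H) ⇔ (φ g ∈ ⁅ e Q ⁆)
  inKernel g = mk⇔ (λ g∈H → Equivalence.from x∈⁅y⁆⇔x≡y (Equivalence.to (kernel g) g∈H))
                   (λ φg∈ → Equivalence.from (kernel g) (Equivalence.to x∈⁅y⁆⇔x≡y φg∈))

  inflation : Inflation G Q H ⁅ e Q ⁆
  inflation = record
    { ψ = φ ; surjective = proj₁ (proj₂ quotient) ; homomorphic = homomorphic
    ; sameCoset = λ g g' → isYes-⇔ (_ ∈? H) (_ ∈? ⁅ e Q ⁆)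
        (subst (λ q → ((g' ·G inv G g) ∈ H) ⇔ (q ∈ ⁅ e Q ⁆))
               (trans (homomorphic g' (inv G g)) (cong (φ g' ·Q_) (φ-inv g)))
               (inKernel (g' ·G inv G g))) }

  whole : ∀ n → isWholeᵇ G H n ≡ isWholeᵇ Q ⁅ e Q ⁆ n
  whole n = allᵇ-transport φ (proj₁ (proj₂ quotient)) _ _ λ g →
    isYes-⇔ (g ∈? H) (φ g ∈? ⁅ e Q ⁆) (inKernel g)

FunSetoid : Set → Setoid 0ℓ 0ℓ
FunSetoid X = record
  { Carrier = X → Bool ; _≈_ = _≗_
  ; isEquivalence = record { refl = λ _ → refl ; sym = λ f≗g x → sym (f≗g x)
                           ; trans = λ f≗g g≗h x → trans (f≗g x) (g≗h x) } }

RelSetoid : Set → Setoid 0ℓ 0ℓ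
RelSetoid X = record
  { Carrier = X → X → Bool ; _≈_ = _≐_
  ; isEquivalence = record { refl = λ _ _ → refl ; sym = λ R≐S x y → sym (R≐S x y)
                           ; trans = λ R≐S S≐T x y → trans (R≐S x y) (S≐T x y) } }

module _ (k : ℕ) where
  open Membership (FunSetoid (Fin (suc k))) using () renaming (_∈_ to _∈₊_)

  extensions : (Fin k → Bool) → List (Fin (suc k) → Bool)
  extensions h = consF false h ∷ consF true h ∷ []

  restricts : ∀ {v h} → v ∈₊ extensions h → (λ i → v (suc i)) ≗ h
  restricts (here v≗) i = v≗ (suc i)
  restricts (there (here v≗)) i = v≗ (suc i)

  extends : ∀ (f : Fin (suc k) → Bool) {h} → (λ i → f (suc i)) ≗ h → f ∈₊ extensions h
  extends f f≗h with f zero in f0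
  ... | false = here λ { zero → f0 ; (suc i) → f≗h i }
  ... | true  = there (here λ { zero → f0 ; (suc i) → f≗h i })

  extensions-unique : ∀ h → Unique (FunSetoid (Fin (suc k))) (extensions h)
  extensions-unique h = ((λ eq → contradiction (eq zero) λ ()) All.∷ All.[]) ∷ All.[] ∷ []

allFns-complete : ∀ k (f : Fin k → Bool) → Membership._∈_ (FunSetoid (Fin k)) f (allFns k)
allFns-complete zero f = here λ ()
allFns-complete (suc k) f = ∈-concatMap⁺ (FunSetoid (Fin k)) (FunSetoid (Fin (suc k)))
  (Any.map (extends k f) (allFns-complete k (λ i → f (suc i))))

allFns-unique : ∀ k → Unique (FunSetoid (Fin k)) (allFns k)
allFns-unique zero = All.[] ∷ []
allFns-unique (suc k) = Unique.concat⁺ (FunSetoid (Fin (suc k)))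
  (All.map⁺ (All.universal (extensions-unique k) (allFns k)))
  (AllPairs.map⁺ (AllPairs.map disjoint (allFns-unique k)))
  where
  disjoint : ∀ {h h'} → ¬ (h ≗ h') → Disjoint (FunSetoid (Fin (suc k))) (extensions k h) (extensions k h')
  disjoint h≉h' (v∈ , v∈') = h≉h' λ i → trans (sym (restricts k v∈ i)) (restricts k v∈' i)

module Enumeration (K : FinGroup) (L : Subset (N K)) (n : ℕ) where
  open Membership (RelSetoid (Pt K L n)) using () renaming (_∈_ to _∈ₗ_)

  size : ℕ
  size = n * N K

  encode : Pt K L n → Fin size
  encode (i , g) = combine i g

  index : Pt K L n → Pt K L n → Fin (size * size)
  index x y = combine (encode x) (encode y)

  decodePt : Fin size → Pt K L n
  decodePt = remQuot {n} (N K)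

  fst snd : Fin (size * size) → Pt K L n
  fst m = decodePt (proj₁ (remQuot {size} size m))
  snd m = decodePt (proj₂ (remQuot {size} size m))

  index-onto : ∀ m → index (fst m) (snd m) ≡ m
  index-onto m = trans (cong₂ combine (combine-remQuot {n} (N K) a) (combine-remQuot {n} (N K) b))
                       (combine-remQuot {size} size m)
    where
    a b : Fin size
    a = proj₁ (remQuot {size} size m)
    b = proj₂ (remQuot {size} size m)

  fst-index : ∀ x y → fst (index x y) ≡ x
  fst-index (i , g) y =
    trans (cong (λ (ab : Fin size × Fin size) → decodePt (proj₁ ab))
                (remQuot-combine {size} {size} (encode (i , g)) (encode y)))
          (remQuot-combine {n} {N K} i g)

  snd-index : ∀ x y → snd (index x y) ≡ y
  snd-index x (j , g) =
    trans (cong (λ (ab : Fin size × Fin size) → decodePt (proj₂ ab))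
                (remQuot-combine {size} {size} (encode x) (encode (j , g))))
          (remQuot-combine {n} {N K} j g)

  -- allRels K L n is, by definition, map decode (allFns (size * size)).
  decode : (Fin (size * size) → Bool) → BRel K L n
  decode f x y = f (index x y)

  allRels-complete : ∀ R → R ∈ₗ allRels K L n
  allRels-complete R = ∈-resp-≈ (RelSetoid (Pt K L n)) R≐decode
    (∈-map⁺ (FunSetoid _) (RelSetoid (Pt K L n)) (λ f≗f' x y → f≗f' (index x y)) (allFns-complete _ f))
    where
    f : Fin (size * size) → Bool
    f m = R (fst m) (snd m)
    R≐decode : decode f ≐ R
    R≐decode x y = cong₂ R (fst-index x y) (snd-index x y)

  allRels-unique : Unique (RelSetoid (Pt K L n)) (allRels K L n)
  allRels-unique = Unique.map⁺ (FunSetoid _) (RelSetoid (Pt K L n)) injective (allFns-unique _)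
    where
    injective : ∀ {f f'} → decode f ≐ decode f' → f ≗ f'
    injective {f} {f'} eq m = subst (λ m → f m ≡ f' m) (index-onto m) (eq (fst m) (snd m))

  -- isProperᵇ respects ≐ (transport along the identity inflation).
  proper-resp : ∀ {R R'} → R ≐ R' → isProperᵇ K L n R ≡ true → isProperᵇ K L n R' ≡ true
  proper-resp R≐R' = trans (sym (Transport.proper-transport (idInflation K L) n R≐R'))

  ΠStar-unique : Unique (RelSetoid (Pt K L n)) (ΠStar K L n)
  ΠStar-unique = Unique.filter⁺ (RelSetoid (Pt K L n)) _ allRels-unique

  ∈-ΠStar⁺ : ∀ {R} → isProperᵇ K L n R ≡ true → R ∈ₗ ΠStar K L n
  ∈-ΠStar⁺ {R} = ∈-filter⁺ (RelSetoid (Pt K L n)) _ proper-resp (allRels-complete R)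

  ∈-ΠStar⁻ : ∀ {R} → R ∈ₗ ΠStar K L n → isProperᵇ K L n R ≡ true
  ∈-ΠStar⁻ {R} R∈ = proj₂ (∈-filter⁻ (RelSetoid (Pt K L n)) _ proper-resp {xs = allRels K L n} R∈)

isOne-independent : ∀ K L K' L' n m → isOneᵇ K L n m ≡ isOneᵇ K' L' n m
isOne-independent K L K' L' n zero          = refl
isOne-independent K L K' L' n (suc zero)    = refl
isOne-independent K L K' L' n (suc (suc m)) = refl

comparable-resp : ∀ K L n {R R' S S'} → R ≐ R' → S ≐ S' →
                  comparable (_⊆ᵇ_ K L n) R S ≡ comparable (_⊆ᵇ_ K L n) R' S'
comparable-resp K L n R≐ S≐ = cong₂ _∨_ (⊆-transport R≐ S≐) (⊆-transport S≐ R≐)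
  where open Transport (idInflation K L) n

module Comparison (G : FinGroup) (H : Subset (N G)) (Q : FinGroup) (φ : Fin (N G) → Fin (N Q))
                  (quotient : IsQuotientBy G H Q φ) (n : ℕ) (e∈H : e G ∈ H) where
  open Transport (Quotient.inflation G H Q φ quotient) n
  module EG = Enumeration G H n
  module EQ = Enumeration Q ⁅ e Q ⁆ n

  open import Data.List.Membership.Setoid (RelSetoid (Pt G H n)) using () renaming (_∈_ to _∈G_)
  open import Data.List.Relation.Binary.Permutation.Setoid (RelSetoid (Pt G H n)) using (_↭_)

  pullback-resp : ∀ {S S'} → S ≐ S' → pullback S ≐ pullback S'
  pullback-resp S≐S' x y = S≐S' (lift x) (lift y)

  pullback-⊆ : ∀ S S' → _⊆ᵇ_ G H n (pullback S) (pullback S') ≡ _⊆ᵇ_ Q ⁅ e Q ⁆ n S S'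
  pullback-⊆ S S' = ⊆-transport {pullback S} {pullback S'} {S} {S'} (λ _ _ → refl) (λ _ _ → refl)

  descends : ∀ {R} → R ∈G ΠStar G H n → R ∈G map pullback (ΠStar Q ⁅ e Q ⁆ n)
  descends {R} R∈ = ∈-resp-≈ (RelSetoid _) (λ x y → sym (R≐ x y))
    (∈-map⁺ (RelSetoid (Pt Q ⁅ e Q ⁆ n)) (RelSetoid (Pt G H n)) (λ {S} {S'} → pullback-resp {S} {S'}) {descend R}
            (EQ.∈-ΠStar⁺ (trans (sym (proper-transport R≐)) properR)))
    where
    properR : isProperᵇ G H n R ≡ true
    properR = EG.∈-ΠStar⁻ R∈
    R≐ : R ≐ pullback (descend R)
    R≐ = pullback-descend (≈-reflexive G H n e∈H) R (∧-conicalˡ _ _ properR)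

  inflates : ∀ {R} → R ∈G map pullback (ΠStar Q ⁅ e Q ⁆ n) → R ∈G ΠStar G H n
  inflates R∈ with S , S∈ , R≐ ← ∈-map⁻ (RelSetoid (Pt Q ⁅ e Q ⁆ n)) (RelSetoid (Pt G H n)) R∈ =
    EG.∈-ΠStar⁺ (trans (proper-transport R≐) (EQ.∈-ΠStar⁻ S∈))

  ΠStar-↭ : ΠStar G H n ↭ map pullback (ΠStar Q ⁅ e Q ⁆ n)
  ΠStar-↭ = unique-↭ (RelSetoid (Pt G H n)) EG.ΠStar-unique
    (Unique.map⁺ (RelSetoid _) (RelSetoid _) pullback-injective EQ.ΠStar-unique) descends inflates

  χ̃-ΠStar : χ̃ (ΠStar G H n) (_⊆ᵇ_ G H n) ≡ χ̃ (ΠStar Q ⁅ e Q ⁆ n) (_⊆ᵇ_ Q ⁅ e Q ⁆ n)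
  χ̃-ΠStar = begin
    chainSum (comparable (_⊆ᵇ_ G H n)) (ΠStar G H n)
      ≡⟨ PermutationInvariance.chainSum-↭ (RelSetoid (Pt G H n)) (comparable (_⊆ᵇ_ G H n))
           (λ R S → ∨-comm (_⊆ᵇ_ G H n R S) (_⊆ᵇ_ G H n S R)) (comparable-resp G H n) ΠStar-↭ ⟩
    chainSum (comparable (_⊆ᵇ_ G H n)) (map pullback (ΠStar Q ⁅ e Q ⁆ n))
      ≡⟨ chainSum-map pullback (comparable (_⊆ᵇ_ G H n)) (comparable (_⊆ᵇ_ Q ⁅ e Q ⁆ n))
           (λ S S' → cong₂ _∨_ (pullback-⊆ S S') (pullback-⊆ S' S)) (ΠStar Q ⁅ e Q ⁆ n) ⟩
    chainSum (comparable (_⊆ᵇ_ Q ⁅ e Q ⁆ n)) (ΠStar Q ⁅ e Q ⁆ n) ∎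
    where open ≡-Reasoning

lemma3p9 : (G : FinGroup) (H : Subset (N G)) → IsNormalSubgroup G H
    → (Q : FinGroup) (φ : Fin (N G) → Fin (N Q)) → IsQuotientBy G H Q φ
    → (n : ℕ) → 1 ≤ n
    → μ G H n ≡ μ Q ⁅ e Q ⁆ n
-- Both sides are "if n = 1 and the subgroup is everything then 1 else χ̃(Π*)": the tests
-- agree since H = G iff {e} = Q, and the Euler characteristics agree by χ̃-ΠStar.
lemma3p9 G H normal Q φ quotient n _ =
  cong₂ (λ b χ → if b then + 1 else χ)
        (cong₂ _∧_ (isOne-independent G H Q ⁅ e Q ⁆ n n) (Quotient.whole G H Q φ quotient n))
        (Comparison.χ̃-ΠStar G H Q φ quotient n e∈H)
  where
  e∈H : e G ∈ H
  e∈H = IsSubgroup.e∈ (IsNormalSubgroup.isSubgroup normal)
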